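{- Let $G$ and $H$ be nontrivial, connected graphs such that the direct product $G \times H$ is well-covered. If $G$ has no isolatable vertices, then $G$ is a complete graph.
   Context: All graphs are finite and simple; nontrivial means having at least two vertices. The direct product $G\times H$ has vertex set $V(G)\times V(H)$, with $(g_1,h_1)(g_2,h_2)$ an edge iff $g_1g_2\in E(G)$ and $h_1h_2\in E(H)$. A graph is well-covered if all of its maximal (with respect to inclusion) independent sets have the same cardinality. A vertex $x$ of $G$ is isolatable if there exists an independent set $I$ of $G$ such that $x$ is an isolated vertex of $G-N[I]$ (here $N[I]$ is the closed neighborhood of $I$, and $I$ may be empty). -}

module Defs where

open import Data.Nat using (ℕ; _*_; _≤_)
open import Data.Bool using (Bool; true; false; _∧_)
open import Data.Fin using (Fin; remQuot)
open import Data.Fin.Subset using (Subset; _∈_; _∉_; _⊆_; ∣_∣)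
open import Data.Product using (Σ; _×_; _,_; proj₁; proj₂)
open import Data.Sum using (_⊎_)
open import Relation.Nullary using (¬_)
open import Relation.Binary.PropositionalEquality using (_≡_; _≢_; refl; cong₂)

record Graph : Set where
  field
    n      : ℕ
    adj    : Fin n → Fin n → Bool
    sym    : ∀ x y → adj x y ≡ adj y x
    irrefl : ∀ x → adj x x ≡ false

open Graph public

Vertex : Graph → Set
Vertex G = Fin (n G)

Adj : (G : Graph) → Vertex G → Vertex G → Set
Adj G x y = adj G x y ≡ true

Nontrivial : Graph → Set
Nontrivial G = 2 ≤ n G

data Reachable (G : Graph) : Vertex G → Vertex G → Set where
  here : ∀ {x} → Reachable G x x
  step : ∀ {x y z} → Adj G x y → Reachable G y z → Reachable G x z

Connected : Graph → Set
Connected G = ∀ x y → Reachable G x y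

Complete : Graph → Set
Complete G = ∀ x y → x ≢ y → Adj G x y

Independent : (G : Graph) → Subset (n G) → Set
Independent G S = ∀ x y → x ∈ S → y ∈ S → ¬ Adj G x y

MaximalIndependent : (G : Graph) → Subset (n G) → Set
MaximalIndependent G S =
  Independent G S × (∀ T → Independent G T → S ⊆ T → T ⊆ S)

WellCovered : Graph → Set
WellCovered G = ∀ S T → MaximalIndependent G S → MaximalIndependent G T →
  ∣ S ∣ ≡ ∣ T ∣

InClosedNbhd : (G : Graph) → Subset (n G) → Vertex G → Set
InClosedNbhd G I y = y ∈ I ⊎ Σ (Vertex G) (λ i → i ∈ I × Adj G i y)

-- x is an isolated vertex of G - N[I] for some independent set I
Isolatable : (G : Graph) → Vertex G → Set
Isolatable G x = Σ (Subset (n G)) λ I →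
  Independent G I ×
  ¬ InClosedNbhd G I x ×
  (∀ y → ¬ InClosedNbhd G I y → ¬ Adj G x y)

-- direct (tensor/categorical) product; vertex (g , h) encoded in
-- Fin (n G * n H) via remQuot
-- the G- and H-coordinates of a product vertex
fstᵛ : (G H : Graph) → Fin (n G * n H) → Vertex G
fstᵛ G H u = proj₁ (remQuot {n G} (n H) u)

sndᵛ : (G H : Graph) → Fin (n G * n H) → Vertex H
sndᵛ G H u = proj₂ (remQuot {n G} (n H) u)

×-adj : (G H : Graph) → Fin (n G * n H) → Fin (n G * n H) → Bool
×-adj G H u v =
  adj G (fstᵛ G H u) (fstᵛ G H v) ∧ adj H (sndᵛ G H u) (sndᵛ G H v)

×-sym : (G H : Graph) → ∀ u v → ×-adj G H u v ≡ ×-adj G H v u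
×-sym G H u v = cong₂ _∧_
  (sym G (fstᵛ G H u) (fstᵛ G H v)) (sym H (sndᵛ G H u) (sndᵛ G H v))

×-irrefl : (G H : Graph) → ∀ u → ×-adj G H u u ≡ false
×-irrefl G H u rewrite irrefl G (fstᵛ G H u) = refl

_×ᵍ_ : Graph → Graph → Graph
G ×ᵍ H = record
  { n = n G * n H
  ; adj = ×-adj G H
  ; sym = ×-sym G H
  ; irrefl = ×-irrefl G H
  }

-- Fix an independent dominating set β of H. For an independent set I of G,
-- L(I) = I × V(H) ∪ (V(G) ∖ N[I]) × β is independent in G × H, and it is
-- maximal because H has no isolated vertices and, G having no isolatable
-- vertex, every vertex outside N[I] has a neighbour outside N[I].
-- If u – v – w were an induced path of G, then (v, b) with b ∈ β lies in
-- L(∅) but in neither L{u} nor L{w}, which gives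
--   L{u} ∪ L{w} ⊂ L{u,w} ∪ L(∅)   and   L{u} ∩ L{w} ⊆ L{u,w} ∩ L(∅),
-- hence |L{u}| + |L{w}| < |L{u,w}| + |L(∅)|, contradicting well-coveredness.
-- A connected graph without induced paths on three vertices is complete.
module Submission where

open import Data.Bool using (true; _∧_)
import Data.Bool as Bool
open import Data.Empty using (⊥-elim)
open import Function using (_∘_; id)
open import Data.Fin using (Fin; zero; combine; punchIn; fromℕ<; _≟_)
open import Data.Fin.Properties using (remQuot-combine; punchInᵢ≢i; any?)
open import Data.Fin.Subset
  using (Subset; inside; outside; _∈_; _∉_; _⊆_; _⊂_; _∪_; _∩_; ⁅_⁆; ∣_∣)
  renaming (⊥ to ∅)
open import Data.Fin.Subset.Properties
  using (_∈?_; ∉⊥; x∈⁅x⁆; x∈⁅y⁆⇒x≡y; x∈p∪q⁺; x∈p∪q⁻; x∈p∩q⁺; x∈p∩q⁻;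
         p⊆p∪q; q⊆p∪q; p⊆q⇒∣p∣≤∣q∣; p⊂q⇒∣p∣<∣q∣)
open import Data.List using (List; []; _∷_; allFin)
open import Data.List.Membership.Propositional using () renaming (_∈_ to _∈ₗ_)
open import Data.List.Membership.Propositional.Properties using (∈-allFin)
open import Data.List.Relation.Unary.Any using (here; there)
open import Data.Nat using (suc; _+_; _≤_; _<_; s≤s; z≤n)
open import Data.Nat.Properties
  using (+-suc; +-mono-<-≤; <-irrefl; ≤-trans; module ≤-Reasoning)
open import Data.Product using (Σ; ∃; _×_; _,_; proj₁; proj₂)
open import Data.Sum using (_⊎_; inj₁; inj₂; [_,_])
open import Data.Vec using (_∷_; []; tabulate)
open import Data.Vec.Properties using (lookup∘tabulate; lookup⇒[]=; []=⇒lookup)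
open import Relation.Nullary using (¬_; Dec; yes; no; does)
open import Relation.Nullary.Decidable using (_⊎-dec_; _×-dec_; ¬?; dec-true)
open import Relation.Unary using (Pred; Decidable)
open import Relation.Binary.PropositionalEquality
  using (_≡_; _≢_; refl; sym; trans; cong; cong₂; subst; subst₂; module ≡-Reasoning)
open import Defs hiding (sym)

∧-true⁻ : ∀ {x y} → x ∧ y ≡ true → x ≡ true × y ≡ true
∧-true⁻ {true} {true} _ = refl , refl

∧-true⁺ : ∀ {x y} → x ≡ true → y ≡ true → x ∧ y ≡ true
∧-true⁺ refl refl = refl

∃-≢ : ∀ {m} → 2 ≤ m → (x : Fin m) → ∃ λ y → y ≢ x
∃-≢ (s≤s (s≤s _)) x = punchIn x zero , punchInᵢ≢i x zero

fromDec : ∀ {m p} {P : Pred (Fin m) p} → Decidable P → Subset m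
fromDec P? = tabulate (λ x → does (P? x))

module _ {m p} {P : Pred (Fin m) p} (P? : Decidable P) where

  ∈fromDec⁺ : ∀ {x} → P x → x ∈ fromDec P?
  ∈fromDec⁺ {x} px =
    lookup⇒[]= x _ (trans (lookup∘tabulate _ x) (dec-true (P? x) px))

  ∈fromDec⁻ : ∀ {x} → x ∈ fromDec P? → P x
  ∈fromDec⁻ {x} x∈ with P? x | trans (sym (lookup∘tabulate _ x)) ([]=⇒lookup x∈)
  ... | yes px | _ = px
  ... | no _   | ()

∣p∪q∣+∣p∩q∣≡∣p∣+∣q∣ : ∀ {m} (p q : Subset m) → ∣ p ∪ q ∣ + ∣ p ∩ q ∣ ≡ ∣ p ∣ + ∣ q ∣
∣p∪q∣+∣p∩q∣≡∣p∣+∣q∣ []            []            = refl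
∣p∪q∣+∣p∩q∣≡∣p∣+∣q∣ (outside ∷ p) (outside ∷ q) = ∣p∪q∣+∣p∩q∣≡∣p∣+∣q∣ p q
∣p∪q∣+∣p∩q∣≡∣p∣+∣q∣ (inside  ∷ p) (outside ∷ q) = cong suc (∣p∪q∣+∣p∩q∣≡∣p∣+∣q∣ p q)
∣p∪q∣+∣p∩q∣≡∣p∣+∣q∣ (outside ∷ p) (inside  ∷ q) =
  trans (cong suc (∣p∪q∣+∣p∩q∣≡∣p∣+∣q∣ p q)) (sym (+-suc ∣ p ∣ ∣ q ∣))
∣p∪q∣+∣p∩q∣≡∣p∣+∣q∣ (inside  ∷ p) (inside  ∷ q) = cong suc (begin
  ∣ p ∪ q ∣ + suc ∣ p ∩ q ∣  ≡⟨ +-suc ∣ p ∪ q ∣ ∣ p ∩ q ∣ ⟩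
  suc (∣ p ∪ q ∣ + ∣ p ∩ q ∣) ≡⟨ cong suc (∣p∪q∣+∣p∩q∣≡∣p∣+∣q∣ p q) ⟩
  suc (∣ p ∣ + ∣ q ∣)         ≡⟨ sym (+-suc ∣ p ∣ ∣ q ∣) ⟩
  ∣ p ∣ + suc ∣ q ∣           ∎)
  where open ≡-Reasoning

⁅⁆-disjoint : ∀ {m} {x y z : Fin m} → x ≢ y → z ∈ ⁅ x ⁆ → z ∉ ⁅ y ⁆
⁅⁆-disjoint {x = x} {y} x≢y z∈⁅x⁆ z∈⁅y⁆ =
  x≢y (trans (sym (x∈⁅y⁆⇒x≡y x z∈⁅x⁆)) (x∈⁅y⁆⇒x≡y y z∈⁅y⁆))

∣p∣+∣q∣<∣r∣+∣s∣ : ∀ {m} {p q r s : Subset m} →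
  p ∪ q ⊂ r ∪ s → p ∩ q ⊆ r ∩ s → ∣ p ∣ + ∣ q ∣ < ∣ r ∣ + ∣ s ∣
∣p∣+∣q∣<∣r∣+∣s∣ {p = p} {q} {r} {s} p∪q⊂r∪s p∩q⊆r∩s =
  subst₂ _<_ (∣p∪q∣+∣p∩q∣≡∣p∣+∣q∣ p q) (∣p∪q∣+∣p∩q∣≡∣p∣+∣q∣ r s)
    (+-mono-<-≤ (p⊂q⇒∣p∣<∣q∣ p∪q⊂r∪s) (p⊆q⇒∣p∣≤∣q∣ p∩q⊆r∩s))

module _ (G : Graph) where

  Adj-sym : ∀ {x y} → Adj G x y → Adj G y x
  Adj-sym {x} {y} x~y = trans (Graph.sym G y x) x~y

  Adj-irrefl : ∀ {x} → ¬ Adj G x x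
  Adj-irrefl {x} x~x with () ← trans (sym x~x) (irrefl G x)

  Adj? : ∀ x y → Dec (Adj G x y)
  Adj? x y = adj G x y Bool.≟ true

  closedNbhd? : ∀ I y → Dec (InClosedNbhd G I y)
  closedNbhd? I y = y ∈? I ⊎-dec any? (λ i → i ∈? I ×-dec Adj? i y)

  InClosedNbhd-mono : ∀ {I J y} → I ⊆ J → InClosedNbhd G I y → InClosedNbhd G J y
  InClosedNbhd-mono I⊆J (inj₁ y∈I)           = inj₁ (I⊆J y∈I)
  InClosedNbhd-mono I⊆J (inj₂ (i , i∈I , i~y)) = inj₂ (i , I⊆J i∈I , i~y)

  InClosedNbhd-∪⁻ : ∀ I J {y} → InClosedNbhd G (I ∪ J) y →
    InClosedNbhd G I y ⊎ InClosedNbhd G J y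
  InClosedNbhd-∪⁻ I J (inj₁ y∈I∪J) with x∈p∪q⁻ I J y∈I∪J
  ... | inj₁ y∈I = inj₁ (inj₁ y∈I)
  ... | inj₂ y∈J = inj₂ (inj₁ y∈J)
  InClosedNbhd-∪⁻ I J (inj₂ (i , i∈I∪J , i~y)) with x∈p∪q⁻ I J i∈I∪J
  ... | inj₁ i∈I = inj₁ (inj₂ (i , i∈I , i~y))
  ... | inj₂ i∈J = inj₂ (inj₂ (i , i∈J , i~y))

  ∉InClosedNbhd-∅ : ∀ {y} → ¬ InClosedNbhd G ∅ y
  ∉InClosedNbhd-∅ (inj₁ y∈∅)           = ∉⊥ y∈∅
  ∉InClosedNbhd-∅ (inj₂ (_ , i∈∅ , _)) = ∉⊥ i∈∅

  Adj⇒∉⁅⁆ : ∀ {x y} → Adj G x y → y ∉ ⁅ x ⁆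
  Adj⇒∉⁅⁆ {x} x~y y∈⁅x⁆ = Adj-irrefl (subst (Adj G x) (x∈⁅y⁆⇒x≡y x y∈⁅x⁆) x~y)

  ¬Adj⇒∉N[⁅⁆] : ∀ {x y} → x ≢ y → ¬ Adj G y x → ¬ InClosedNbhd G ⁅ y ⁆ x
  ¬Adj⇒∉N[⁅⁆] {y = y} x≢y y≁x (inj₁ x∈⁅y⁆) = x≢y (x∈⁅y⁆⇒x≡y y x∈⁅y⁆)
  ¬Adj⇒∉N[⁅⁆] {x} {y} x≢y y≁x (inj₂ (i , i∈⁅y⁆ , i~x)) =
    y≁x (subst (λ i → Adj G i x) (x∈⁅y⁆⇒x≡y y i∈⁅y⁆) i~x)

  ∅-independent : Independent G ∅
  ∅-independent _ _ x∈∅ _ = ⊥-elim (∉⊥ x∈∅)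

  ⁅⁆-independent : ∀ x → Independent G ⁅ x ⁆
  ⁅⁆-independent x y z y∈ z∈
    rewrite x∈⁅y⁆⇒x≡y x y∈ | x∈⁅y⁆⇒x≡y x z∈ = Adj-irrefl

  insert-independent : ∀ {I x} → Independent G I → ¬ InClosedNbhd G I x →
    Independent G (⁅ x ⁆ ∪ I)
  insert-independent {I} {x} indI x∉N[I] y z y∈ z∈
    with x∈p∪q⁻ ⁅ x ⁆ I y∈ | x∈p∪q⁻ ⁅ x ⁆ I z∈
  ... | inj₁ y∈⁅x⁆ | inj₁ z∈⁅x⁆ = ⁅⁆-independent x y z y∈⁅x⁆ z∈⁅x⁆
  ... | inj₁ y∈⁅x⁆ | inj₂ z∈I rewrite x∈⁅y⁆⇒x≡y x y∈⁅x⁆ =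
    λ x~z → x∉N[I] (inj₂ (z , z∈I , Adj-sym x~z))
  ... | inj₂ y∈I | inj₁ z∈⁅x⁆ rewrite x∈⁅y⁆⇒x≡y x z∈⁅x⁆ =
    λ y~x → x∉N[I] (inj₂ (y , y∈I , y~x))
  ... | inj₂ y∈I | inj₂ z∈I = indI y z y∈I z∈I

  Dominating : Subset (n G) → Set
  Dominating S = ∀ x → InClosedNbhd G S x

  independent-dominating⇒maximal : ∀ {S} → Independent G S → Dominating S →
    MaximalIndependent G S
  independent-dominating⇒maximal {S} indS domS = indS , maximal
    where
    maximal : ∀ T → Independent G T → S ⊆ T → T ⊆ S
    maximal T indT S⊆T {x} x∈T with domS x
    ... | inj₁ x∈S             = x∈S
    ... | inj₂ (y , y∈S , y~x) = ⊥-elim (indT y x (S⊆T y∈S) x∈T y~x)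

  dominating-nonempty : ∀ {S} → Dominating S → Vertex G → ∃ λ x → x ∈ S
  dominating-nonempty domS x with domS x
  ... | inj₁ x∈S           = x , x∈S
  ... | inj₂ (y , y∈S , _) = y , y∈S

  extend : Subset (n G) → Vertex G → Subset (n G)
  extend S x with closedNbhd? S x
  ... | yes _ = S
  ... | no _  = ⁅ x ⁆ ∪ S

  extend-⊇ : ∀ S x → S ⊆ extend S x
  extend-⊇ S x with closedNbhd? S x
  ... | yes _ = λ y∈S → y∈S
  ... | no _  = q⊆p∪q ⁅ x ⁆ S

  extend-independent : ∀ {S} x → Independent G S → Independent G (extend S x)
  extend-independent {S} x indS with closedNbhd? S x
  ... | yes _      = indS
  ... | no x∉N[S] = insert-independent indS x∉N[S]

  extend-dominates : ∀ S x → InClosedNbhd G (extend S x) x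
  extend-dominates S x with closedNbhd? S x
  ... | yes x∈N[S] = x∈N[S]
  ... | no _       = inj₁ (p⊆p∪q S (x∈⁅x⁆ x))

  greedy : List (Vertex G) → Subset (n G) → Subset (n G)
  greedy []       S = S
  greedy (x ∷ xs) S = greedy xs (extend S x)

  greedy-⊇ : ∀ xs S → S ⊆ greedy xs S
  greedy-⊇ []       S y∈S = y∈S
  greedy-⊇ (x ∷ xs) S y∈S = greedy-⊇ xs (extend S x) (extend-⊇ S x y∈S)

  greedy-independent : ∀ xs {S} → Independent G S → Independent G (greedy xs S)
  greedy-independent []       indS = indS
  greedy-independent (x ∷ xs) indS = greedy-independent xs (extend-independent x indS)

  greedy-dominates : ∀ {xs} S {x} → x ∈ₗ xs → InClosedNbhd G (greedy xs S) x
  greedy-dominates {x ∷ xs} S (here refl) =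
    InClosedNbhd-mono (greedy-⊇ xs (extend S x)) (extend-dominates S x)
  greedy-dominates {y ∷ xs} S (there x∈xs) = greedy-dominates (extend S y) x∈xs

  ∃-independent-dominating : Σ (Subset (n G)) λ S → Independent G S × Dominating S
  ∃-independent-dominating =
    greedy (allFin _) ∅ , greedy-independent (allFin _) ∅-independent ,
    λ x → greedy-dominates ∅ (∈-allFin x)

  reachable-≢⇒∃-neighbour : ∀ {x y} → Reachable G x y → y ≢ x → ∃ λ z → Adj G x z
  reachable-≢⇒∃-neighbour here         y≢x = ⊥-elim (y≢x refl)
  reachable-≢⇒∃-neighbour (step x~z _) _   = _ , x~z

  ∃-neighbour : Nontrivial G → Connected G → ∀ x → ∃ λ y → Adj G x y
  ∃-neighbour nt conn x with ∃-≢ nt x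
  ... | y , y≢x = reachable-≢⇒∃-neighbour (conn x y) y≢x

  ¬Isolatable⇒outer-neighbour : ∀ {I x} → ¬ Isolatable G x → Independent G I →
    ¬ InClosedNbhd G I x → ∃ λ y → ¬ InClosedNbhd G I y × Adj G x y
  ¬Isolatable⇒outer-neighbour {I} {x} ¬iso indI x∉N[I]
    with any? (λ y → ¬? (closedNbhd? I y) ×-dec Adj? x y)
  ... | yes found = found
  ... | no none   =
    ⊥-elim (¬iso (I , indI , x∉N[I] , λ y y∉N[I] x~y → none (y , y∉N[I] , x~y)))

  NoInducedP₃ : Set
  NoInducedP₃ = ∀ {u v w} → Adj G u v → Adj G v w → u ≢ w → Adj G u w

  reachable⇒≡⊎Adj : NoInducedP₃ → ∀ {x y} → Reachable G x y → x ≡ y ⊎ Adj G x y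
  reachable⇒≡⊎Adj noP₃ here = inj₁ refl
  reachable⇒≡⊎Adj noP₃ (step {x} {z = z} x~y r) with reachable⇒≡⊎Adj noP₃ r | x ≟ z
  ... | inj₁ refl | _       = inj₂ x~y
  ... | inj₂ _    | yes x≡z = inj₁ x≡z
  ... | inj₂ y~z  | no x≢z  = inj₂ (noP₃ x~y y~z x≢z)

  connected-noInducedP₃⇒complete : Connected G → NoInducedP₃ → Complete G
  connected-noInducedP₃⇒complete conn noP₃ x y x≢y =
    [ ⊥-elim ∘ x≢y , id ] (reachable⇒≡⊎Adj noP₃ (conn x y))

module _ (G H : Graph) where

  fstᵛ-combine : ∀ g h → fstᵛ G H (combine g h) ≡ g
  fstᵛ-combine g h = cong proj₁ (remQuot-combine {n G} {n H} g h)

  sndᵛ-combine : ∀ g h → sndᵛ G H (combine g h) ≡ h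
  sndᵛ-combine g h = cong proj₂ (remQuot-combine {n G} {n H} g h)

  ×-Adj⁻ : ∀ {p q} → Adj (G ×ᵍ H) p q →
    Adj G (fstᵛ G H p) (fstᵛ G H q) × Adj H (sndᵛ G H p) (sndᵛ G H q)
  ×-Adj⁻ = ∧-true⁻

  ×-Adj⁺ : ∀ {g h p} → Adj G g (fstᵛ G H p) → Adj H h (sndᵛ G H p) →
    Adj (G ×ᵍ H) (combine g h) p
  ×-Adj⁺ {g} {h} {p} g~ h~ =
    subst₂ (λ g′ h′ → adj G g′ (fstᵛ G H p) ∧ adj H h′ (sndᵛ G H p) ≡ true)
      (sym (fstᵛ-combine g h)) (sym (sndᵛ-combine g h)) (∧-true⁺ g~ h~)

module Layered (G H : Graph) (β : Subset (n H)) where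

  InLayer : Subset (n G) → Vertex G → Vertex H → Set
  InLayer I g h = g ∈ I ⊎ (¬ InClosedNbhd G I g × h ∈ β)

  InLayered : Subset (n G) → Vertex (G ×ᵍ H) → Set
  InLayered I p = InLayer I (fstᵛ G H p) (sndᵛ G H p)

  inLayered? : ∀ I → Decidable (InLayered I)
  inLayered? I p =
    fstᵛ G H p ∈? I ⊎-dec (¬? (closedNbhd? G I (fstᵛ G H p)) ×-dec sndᵛ G H p ∈? β)

  layered : Subset (n G) → Subset (n (G ×ᵍ H))
  layered I = fromDec (inLayered? I)

  ∈layered⁺ : ∀ {I p} → InLayered I p → p ∈ layered I
  ∈layered⁺ {I} = ∈fromDec⁺ (inLayered? I)

  ∈layered⁻ : ∀ {I p} → p ∈ layered I → InLayered I p
  ∈layered⁻ {I} = ∈fromDec⁻ (inLayered? I)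

  combine∈layered : ∀ {I g h} → InLayer I g h → combine g h ∈ layered I
  combine∈layered {I} {g} {h} m = ∈layered⁺
    (subst₂ (InLayer I) (sym (fstᵛ-combine G H g h)) (sym (sndᵛ-combine G H g h)) m)

  combine∉layered : ∀ {I g h} → g ∉ I → InClosedNbhd G I g → combine g h ∉ layered I
  combine∉layered {I} {g} {h} g∉I g∈N[I] m
    with subst₂ (InLayer I) (fstᵛ-combine G H g h) (sndᵛ-combine G H g h)
           (∈layered⁻ m)
  ... | inj₁ g∈I          = g∉I g∈I
  ... | inj₂ (g∉N[I] , _) = g∉N[I] g∈N[I]

  layered-independent : ∀ {I} → Independent G I → Independent H β →
    Independent (G ×ᵍ H) (layered I)
  layered-independent {I} indI indβ p q p∈ q∈ p~q
    with ×-Adj⁻ G H {p} {q} p~q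
       | ∈layered⁻ p∈ | ∈layered⁻ q∈
  ... | g~g′ , _ | inj₁ g∈I | inj₁ g′∈I = indI _ _ g∈I g′∈I g~g′
  ... | g~g′ , _ | inj₁ g∈I | inj₂ (g′∉N[I] , _) = g′∉N[I] (inj₂ (_ , g∈I , g~g′))
  ... | g~g′ , _ | inj₂ (g∉N[I] , _) | inj₁ g′∈I =
    g∉N[I] (inj₂ (_ , g′∈I , Adj-sym G g~g′))
  ... | _ , h~h′ | inj₂ (_ , h∈β) | inj₂ (_ , h′∈β) = indβ _ _ h∈β h′∈β h~h′

  layered-dominating : ∀ {I} → Independent G I → (∀ x → ¬ Isolatable G x) →
    Dominating H β → (∀ h → ∃ λ h′ → Adj H h h′) → Dominating (G ×ᵍ H) (layered I)
  layered-dominating {I} indI noIso domβ nbH p with inLayered? I p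
  ... | yes p∈ = inj₁ (∈layered⁺ p∈)
  ... | no p∉ with closedNbhd? G I (fstᵛ G H p)
  ...   | yes (inj₁ g∈I) = ⊥-elim (p∉ (inj₁ g∈I))
  ...   | yes (inj₂ (i , i∈I , i~g)) =
    let h′ , h~h′ = nbH (sndᵛ G H p) in
    inj₂ (combine i h′ , combine∈layered (inj₁ i∈I) , ×-Adj⁺ G H i~g (Adj-sym H h~h′))
  ...   | no g∉N[I] with domβ (sndᵛ G H p)
  ...     | inj₁ h∈β = ⊥-elim (p∉ (inj₂ (g∉N[I] , h∈β)))
  ...     | inj₂ (b , b∈β , b~h) =
    let r , r∉N[I] , g~r = ¬Isolatable⇒outer-neighbour G (noIso _) indI g∉N[I] in
    inj₂ (combine r b , combine∈layered (inj₂ (r∉N[I] , b∈β)) , ×-Adj⁺ G H (Adj-sym G g~r) b~h)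

  layered-⊆-∪∅ : ∀ {I J} → I ⊆ J → layered I ⊆ layered J ∪ layered ∅
  layered-⊆-∪∅ I⊆J p∈ with ∈layered⁻ p∈
  ... | inj₁ g∈I       = x∈p∪q⁺ (inj₁ (∈layered⁺ (inj₁ (I⊆J g∈I))))
  ... | inj₂ (_ , h∈β) = x∈p∪q⁺ (inj₂ (∈layered⁺ (inj₂ (∉InClosedNbhd-∅ G , h∈β))))

  layered-∪ : ∀ I J → layered I ∪ layered J ⊆ layered (I ∪ J) ∪ layered ∅
  layered-∪ I J p∈ =
    [ layered-⊆-∪∅ (p⊆p∪q J) , layered-⊆-∪∅ (q⊆p∪q I J) ] (x∈p∪q⁻ (layered I) (layered J) p∈)

  ∈layered-∩∅ : ∀ {I p} → InLayered I p → sndᵛ G H p ∈ β → p ∈ layered I ∩ layered ∅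
  ∈layered-∩∅ p∈L h∈β = x∈p∩q⁺ (∈layered⁺ p∈L , ∈layered⁺ (inj₂ (∉InClosedNbhd-∅ G , h∈β)))

  layered-∩ : ∀ {I J} → (∀ {x} → x ∈ I → x ∉ J) →
    layered I ∩ layered J ⊆ layered (I ∪ J) ∩ layered ∅
  layered-∩ {I} {J} disjoint {p} p∈ with x∈p∩q⁻ (layered I) (layered J) p∈
  ... | p∈LI , p∈LJ with ∈layered⁻ p∈LI | ∈layered⁻ p∈LJ
  ... | inj₁ g∈I | inj₁ g∈J = ⊥-elim (disjoint g∈I g∈J)
  ... | inj₁ g∈I | inj₂ (_ , h∈β) = ∈layered-∩∅ (inj₁ (x∈p∪q⁺ (inj₁ g∈I))) h∈β
  ... | inj₂ (_ , h∈β) | inj₁ g∈J = ∈layered-∩∅ (inj₁ (x∈p∪q⁺ (inj₂ g∈J))) h∈β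
  ... | inj₂ (g∉N[I] , h∈β) | inj₂ (g∉N[J] , _) =
    ∈layered-∩∅ (inj₂ ([ g∉N[I] , g∉N[J] ] ∘ InClosedNbhd-∪⁻ G I J , h∈β)) h∈β

  layered-exchange : ∀ {I J v b} → (∀ {x} → x ∈ I → x ∉ J) →
    v ∉ I → InClosedNbhd G I v → v ∉ J → InClosedNbhd G J v → b ∈ β →
    ∣ layered I ∣ + ∣ layered J ∣ < ∣ layered (I ∪ J) ∣ + ∣ layered ∅ ∣
  layered-exchange {I} {J} {v} {b} disjoint v∉I v∈N[I] v∉J v∈N[J] b∈β =
    ∣p∣+∣q∣<∣r∣+∣s∣ (layered-∪ I J , combine v b , vb∈ , vb∉) (layered-∩ disjoint)
    where
    vb∈ : combine v b ∈ layered (I ∪ J) ∪ layered ∅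
    vb∈ = x∈p∪q⁺ (inj₂ (combine∈layered (inj₂ (∉InClosedNbhd-∅ G , b∈β))))
    vb∉ : combine v b ∉ layered I ∪ layered J
    vb∉ = [ combine∉layered v∉I v∈N[I] , combine∉layered v∉J v∈N[J] ]
          ∘ x∈p∪q⁻ (layered I) (layered J)

noInducedP₃ : (G H : Graph) → Nontrivial H → Connected H → WellCovered (G ×ᵍ H) →
  (∀ x → ¬ Isolatable G x) → NoInducedP₃ G
noInducedP₃ G H ntH connH wc noIso {u} {v} {w} u~v v~w u≢w
  with Adj? G u w | ∃-independent-dominating H
... | yes u~w | _ = u~w
... | no u≁w | β , indβ , domβ
  with dominating-nonempty H domβ (fromℕ< (≤-trans (s≤s z≤n) ntH))
...   | b , b∈β = ⊥-elim (<-irrefl refl (begin-strict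
  ∣ layered ∅ ∣ + ∣ layered ∅ ∣                ≡⟨ sym (cong₂ _+_ (same-size ind-u) (same-size ind-w)) ⟩
  ∣ layered ⁅ u ⁆ ∣ + ∣ layered ⁅ w ⁆ ∣        <⟨ exchange ⟩
  ∣ layered (⁅ u ⁆ ∪ ⁅ w ⁆) ∣ + ∣ layered ∅ ∣  ≡⟨ cong (_+ ∣ layered ∅ ∣) (same-size ind-uw) ⟩
  ∣ layered ∅ ∣ + ∣ layered ∅ ∣                ∎))
  where
  open Layered G H β
  open ≤-Reasoning

  maximal : ∀ {I} → Independent G I → MaximalIndependent (G ×ᵍ H) (layered I)
  maximal indI = independent-dominating⇒maximal (G ×ᵍ H)
    (layered-independent indI indβ)
    (layered-dominating indI noIso domβ (∃-neighbour H ntH connH))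

  same-size : ∀ {I} → Independent G I → ∣ layered I ∣ ≡ ∣ layered ∅ ∣
  same-size indI = wc _ _ (maximal indI) (maximal (∅-independent G))

  ind-u : Independent G ⁅ u ⁆
  ind-u = ⁅⁆-independent G u

  ind-w : Independent G ⁅ w ⁆
  ind-w = ⁅⁆-independent G w

  ind-uw : Independent G (⁅ u ⁆ ∪ ⁅ w ⁆)
  ind-uw = insert-independent G ind-w (¬Adj⇒∉N[⁅⁆] G u≢w (u≁w ∘ Adj-sym G))

  exchange :
    ∣ layered ⁅ u ⁆ ∣ + ∣ layered ⁅ w ⁆ ∣ < ∣ layered (⁅ u ⁆ ∪ ⁅ w ⁆) ∣ + ∣ layered ∅ ∣
  exchange = layered-exchange (⁅⁆-disjoint u≢w)
    (Adj⇒∉⁅⁆ G u~v) (inj₂ (u , x∈⁅x⁆ u , u~v))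
    (Adj⇒∉⁅⁆ G w~v) (inj₂ (w , x∈⁅x⁆ w , w~v)) b∈β
    where
    w~v : Adj G w v
    w~v = Adj-sym G v~w

theorem4p4 : (G H : Graph) → Nontrivial G → Nontrivial H →
    Connected G → Connected H → WellCovered (G ×ᵍ H) →
    (∀ x → ¬ Isolatable G x) → Complete G
-- A one-vertex G is complete.
theorem4p4 G H _ ntH connG connH wc noIso =
  connected-noInducedP₃⇒complete G connG (noInducedP₃ G H ntH connH wc noIso)
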